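{- Let $n,m\geq 2$ and let $K_{n,m}$ be the complete bipartite graph on the labeled vertex set $\{1,\dots,n+m\}$ with parts $\{1,\dots,n\}$ and $\{n+1,\dots,n+m\}$. Then the local equivalence class (LC orbit) of $K_{n,m}$ has size $$|\mathcal{O}(K_{n,m})| = nm+n+m+3.$$
   Context: For a simple graph $G$ and a vertex $v$, the local complement $c_v(G)$ is the graph on the same vertex set obtained by replacing the subgraph induced on the neighbourhood of $v$ by its complement (edges between two neighbours of $v$ are deleted if present and added if absent; all other edges unchanged). Two graphs on the same labeled vertex set are locally equivalent if one is obtained from the other by a finite sequence of local complements. The LC orbit $\mathcal{O}(G)$ is the set of all labeled graphs on the vertex set of $G$ that are locally equivalent to $G$ (graphs are labeled, so isomorphic but distinct labeled graphs are counted separately). -}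

module Defs where

open import Data.Nat using (ℕ; _+_; _<_)
open import Data.Bool using (Bool; true; false; _∧_; _xor_; not)
open import Data.Fin using (Fin; toℕ)
open import Data.Fin.Properties using (_≟_)
open import Data.Vec using (Vec; lookup; tabulate)
open import Relation.Nullary.Decidable using (⌊_⌋)
open import Relation.Binary.Construct.Closure.ReflexiveTransitive using (Star)
open import Data.List using (List)
open import Data.List.Relation.Unary.Unique.Propositional using (Unique)
open import Data.List.Membership.Propositional using (_∈_)
open import Data.Product using (Σ; _×_)
open import Relation.Binary.PropositionalEquality using (_≡_)
open import Function.Bundles using (_⇔_)

-- A labeled graph on vertex set Fin N, given by its adjacency matrix.
-- (Vectors so that equality of graphs is propositional equality of matrices.)
Graph : ℕ → Set
Graph N = Vec (Vec Bool N) N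

adj : ∀ {N} → Graph N → Fin N → Fin N → Bool
adj G i j = lookup (lookup G i) j

localComplement : ∀ {N} → Fin N → Graph N → Graph N
localComplement {N} v G =
  tabulate λ i → tabulate λ j →
    adj G i j xor (not ⌊ i ≟ j ⌋ ∧ adj G v i ∧ adj G v j)

data LCStep {N : ℕ} : Graph N → Graph N → Set where
  lc : ∀ v G → LCStep G (localComplement v G)

LocallyEquivalent : ∀ {N} → Graph N → Graph N → Set
LocallyEquivalent = Star LCStep

OrbitSize : ∀ {N} → Graph N → ℕ → Set
OrbitSize {N} G k =
  Σ (List (Graph N)) λ xs →
    Unique xs × (Data.List.length xs ≡ k) × (∀ H → (H ∈ xs) ⇔ LocallyEquivalent G H)

-- K_{n,m} on vertices 0..n+m-1 (0-indexed version of 1..n+m):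
-- parts {i < n} and {i ≥ n}; i ~ j iff they lie in different parts
inFirst : ∀ {N} → ℕ → Fin N → Bool
inFirst n i = ⌊ Data.Nat._<?_ (toℕ i) n ⌋

completeBipartite : (n m : ℕ) → Graph (n + m)
completeBipartite n m =
  tabulate λ i → tabulate λ j → inFirst n i xor inFirst n j

-- Every graph in the orbit of K_{n,m} is given by vertices a ∈ A, b ∈ B and one of six tables:
-- two distinct vertices are adjacent according to their classes among {a}, A∖{a}, {b}, B∖{b}.
-- Local complementation at a (or b) turns each table into another of the six. At a vertex
-- x ∈ A∖{a}, either a and x are twins, so that x can take over the role of a, or the vertices
-- of A∖{a} are leaves at a and nothing changes; likewise in B. So the orbit consists of the three
-- graphs with all edges between A and B, the n + m hubs at a or at b, and the nm double stars.
-- They are distinct because the edges between A and B form a rectangle R × C with R = A or {a}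
-- and C = B or {b}, which determines a and b when n, m ≥ 2, while the three graphs with the full
-- rectangle differ inside A or inside B.

module Submission where

open import Data.Bool using (Bool; true; false; T; not; _∧_; _xor_)
open import Data.Bool.Properties
  using (∧-distribˡ-xor; ∧-identityʳ; ∧-conicalˡ; ∧-conicalʳ; xor-same)
  renaming (_≟_ to _≟ᵇ_)
open import Data.Fin using (Fin; zero; suc; toℕ; _↑ˡ_; _↑ʳ_; splitAt)
open import Data.Fin.Properties
  using (_≟_; +↔⊎; *↔×; splitAt-↑ˡ; splitAt-↑ʳ; splitAt⁻¹-↑ˡ; splitAt⁻¹-↑ʳ;
         toℕ-↑ˡ; toℕ-↑ʳ; toℕ<n; ↑ˡ-injective; ↑ʳ-injective)
import Data.List as List
open import Data.List.Membership.Propositional using (_∈_)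
open import Data.List.Membership.Propositional.Properties using (∈-tabulate⁺; ∈-tabulate⁻)
open import Data.List.Properties using (length-tabulate)
open import Data.List.Relation.Unary.Unique.Propositional.Properties using (tabulate⁺)
open import Data.Maybe using (Maybe; nothing; just)
open import Data.Nat using (ℕ; _+_; _*_; _<_; _≤_; _<?_; s≤s)
open import Data.Nat.Properties using (m+n≮m)
open import Data.Product using (∃-syntax; _×_; _,_; proj₁; proj₂)
open import Data.Sum using (_⊎_; inj₁; inj₂; [_,_]′)
open import Data.Sum.Function.Propositional using (_⊎-↔_)
open import Data.Vec using (Vec; lookup; tabulate)
open import Data.Vec.Properties using (lookup∘tabulate; tabulate∘lookup; tabulate-cong)
open import Function using (_∘_; id)
open import Function.Bundles using (_↔_; Inverse; mk⇔)
open import Function.Construct.Composition using (_↔-∘_)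
open import Function.Construct.Identity using (↔-id)
open import Relation.Binary.Construct.Closure.ReflexiveTransitive using (ε; _◅_)
open import Relation.Binary.Construct.Closure.ReflexiveTransitive.Properties
  using (module StarReasoning)
open import Relation.Binary.PropositionalEquality
  using (_≡_; _≢_; refl; sym; trans; cong; cong₂; subst; module ≡-Reasoning)
open import Relation.Nullary using (¬_; Dec; yes; no; contradiction)
open import Relation.Nullary.Decidable
  using (⌊_⌋; True; toWitness; from-yes; map′; _×-dec_; _⊎-dec_; _→-dec_; T?;
         isYes≗does; dec-true; dec-false)

open import Defs

⌊≟⌋-true : ∀ {k} {x y : Fin k} → x ≡ y → ⌊ x ≟ y ⌋ ≡ true
⌊≟⌋-true {x = x} {y} x≡y = trans (isYes≗does (x ≟ y)) (dec-true (x ≟ y) x≡y)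

⌊≟⌋-false : ∀ {k} {x y : Fin k} → x ≢ y → ⌊ x ≟ y ⌋ ≡ false
⌊≟⌋-false {x = x} {y} x≢y = trans (isYes≗does (x ≟ y)) (dec-false (x ≟ y) x≢y)

select : ∀ {k} → Maybe (Fin k) → Fin k → Bool
select nothing  _ = true
select (just c) x = ⌊ x ≟ c ⌋

select-nonempty : ∀ {k} (r : Maybe (Fin (1 + k))) → ∃[ x ] select r x ≡ true
select-nonempty nothing  = zero , refl
select-nonempty (just c) = c , ⌊≟⌋-true refl

select-injective : ∀ {k} {r r′ : Maybe (Fin (2 + k))} → (∀ x → select r x ≡ select r′ x) → r ≡ r′
select-injective {r = nothing}       {nothing}       _ = refl
select-injective {r = nothing}       {just zero}     h = contradiction (h (suc zero)) λ ()
select-injective {r = nothing}       {just (suc _)}  h = contradiction (h zero) λ ()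
select-injective {r = just zero}     {nothing}       h = contradiction (h (suc zero)) λ ()
select-injective {r = just (suc _)}  {nothing}       h = contradiction (h zero) λ ()
select-injective {r = just c}        {just c′}       h with c ≟ c′ | h c
... | yes c≡c′ | _      = cong just c≡c′
... | no _     | rejected = contradiction (trans (sym (⌊≟⌋-true {x = c} refl)) rejected) λ ()

rectangle-injective : ∀ {k l} {r r′ : Maybe (Fin (2 + k))} {c c′ : Maybe (Fin (2 + l))} →
  (∀ x y → select r x ∧ select c y ≡ select r′ x ∧ select c′ y) → r ≡ r′ × c ≡ c′
rectangle-injective {k} {l} {r} {r′} {c} {c′} same =
  select-injective rows , select-injective cols
  where
  x₀ : Fin (2 + k)
  x₀ = proj₁ (select-nonempty r)
  y₀ : Fin (2 + l)
  y₀ = proj₁ (select-nonempty c)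
  corner : select r′ x₀ ∧ select c′ y₀ ≡ true
  corner = trans (sym (same x₀ y₀))
                 (cong₂ _∧_ (proj₂ (select-nonempty r)) (proj₂ (select-nonempty c)))
  rows : ∀ x → select r x ≡ select r′ x
  rows x = begin
    select r x                     ≡⟨ ∧-identityʳ _ ⟨
    select r x ∧ true              ≡⟨ cong (select r x ∧_) (proj₂ (select-nonempty c)) ⟨
    select r x ∧ select c y₀       ≡⟨ same x y₀ ⟩
    select r′ x ∧ select c′ y₀     ≡⟨ cong (select r′ x ∧_) (∧-conicalʳ _ _ corner) ⟩
    select r′ x ∧ true             ≡⟨ ∧-identityʳ _ ⟩
    select r′ x                    ∎
    where open ≡-Reasoning
  cols : ∀ y → select c y ≡ select c′ y
  cols y = begin
    select c y                     ≡⟨⟩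
    true ∧ select c y              ≡⟨ cong (_∧ select c y) (proj₂ (select-nonempty r)) ⟨
    select r x₀ ∧ select c y       ≡⟨ same x₀ y ⟩
    select r′ x₀ ∧ select c′ y     ≡⟨ cong (_∧ select c′ y) (∧-conicalˡ _ _ corner) ⟩
    select c′ y                    ∎
    where open ≡-Reasoning

Table : Set → Set
Table L = L → L → Bool

lcTable : {L : Set} → L → Table L → Table L
lcTable s t x y = t x y xor (t s x ∧ t s y)

lookup-ext : {A : Set} {k : ℕ} {u v : Vec A k} → (∀ i → lookup u i ≡ lookup v i) → u ≡ v
lookup-ext {u = u} {v} u≗v =
  trans (sym (tabulate∘lookup u)) (trans (tabulate-cong u≗v) (tabulate∘lookup v))

module _ {N : ℕ} where

  graph-ext : {G H : Graph N} → (∀ i j → adj G i j ≡ adj H i j) → G ≡ H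
  graph-ext G≗H = lookup-ext λ i → lookup-ext (G≗H i)

  adj-tabulate : (f : Fin N → Fin N → Bool) (i j : Fin N) →
                 adj (tabulate λ i → tabulate (f i)) i j ≡ f i j
  adj-tabulate f i j rewrite lookup∘tabulate (λ i → tabulate (f i)) i = lookup∘tabulate (f i) j

  tableGraph : {L : Set} → (Fin N → L) → Table L → Graph N
  tableGraph ℓ t = tabulate λ i → tabulate λ j → not ⌊ i ≟ j ⌋ ∧ t (ℓ i) (ℓ j)

  adj-tableGraph : {L : Set} (ℓ : Fin N → L) (t : Table L) {i j : Fin N} → i ≢ j →
                   adj (tableGraph ℓ t) i j ≡ t (ℓ i) (ℓ j)
  adj-tableGraph ℓ t {i} {j} i≢j
    rewrite adj-tabulate (λ i j → not ⌊ i ≟ j ⌋ ∧ t (ℓ i) (ℓ j)) i j | ⌊≟⌋-false i≢j = refl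

  tableGraph-cong : {L L′ : Set} (ℓ : Fin N → L) (ℓ′ : Fin N → L′) (t : Table L) (t′ : Table L′) →
                    (∀ {i j} → i ≢ j → t (ℓ i) (ℓ j) ≡ t′ (ℓ′ i) (ℓ′ j)) →
                    tableGraph ℓ t ≡ tableGraph ℓ′ t′
  tableGraph-cong ℓ ℓ′ t t′ agree = graph-ext λ i j → offDiagonal i j (i ≟ j)
    where
    offDiagonal : ∀ i j → Dec (i ≡ j) → adj (tableGraph ℓ t) i j ≡ adj (tableGraph ℓ′ t′) i j
    offDiagonal i .i (yes refl)
      rewrite adj-tabulate (λ i j → not ⌊ i ≟ j ⌋ ∧ t (ℓ i) (ℓ j)) i i
            | adj-tabulate (λ i j → not ⌊ i ≟ j ⌋ ∧ t′ (ℓ′ i) (ℓ′ j)) i i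
            | ⌊≟⌋-true {x = i} refl = refl
    offDiagonal i j (no i≢j) =
      trans (adj-tableGraph ℓ t i≢j) (trans (agree i≢j) (sym (adj-tableGraph ℓ′ t′ i≢j)))

  tableGraph-≗ : {L : Set} {ℓ ℓ′ : Fin N → L} (t : Table L) →
                 (∀ i → ℓ i ≡ ℓ′ i) → tableGraph ℓ t ≡ tableGraph ℓ′ t
  tableGraph-≗ {ℓ = ℓ} {ℓ′} t ℓ≗ℓ′ =
    tableGraph-cong ℓ ℓ′ t t λ {i} {j} _ → cong₂ t (ℓ≗ℓ′ i) (ℓ≗ℓ′ j)

  localComplement-tableGraph : {L : Set} (ℓ : Fin N → L) (t : Table L) (v : Fin N) →
    t (ℓ v) (ℓ v) ≡ false →
    localComplement v (tableGraph ℓ t) ≡ tableGraph ℓ (lcTable (ℓ v) t)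
  localComplement-tableGraph {L} ℓ t v loopless = graph-ext λ i j → begin
    adj (localComplement v G) i j
      ≡⟨ adj-tabulate (λ i j → adj G i j xor (not ⌊ i ≟ j ⌋ ∧ adj G v i ∧ adj G v j)) i j ⟩
    adj G i j xor (not ⌊ i ≟ j ⌋ ∧ adj G v i ∧ adj G v j)
      ≡⟨ cong₂ (λ p q → adj G i j xor (not ⌊ i ≟ j ⌋ ∧ p ∧ q)) (neighbour i) (neighbour j) ⟩
    adj G i j xor (not ⌊ i ≟ j ⌋ ∧ t s (ℓ i) ∧ t s (ℓ j))
      ≡⟨ cong (_xor (not ⌊ i ≟ j ⌋ ∧ t s (ℓ i) ∧ t s (ℓ j)))
              (adj-tabulate (λ i j → not ⌊ i ≟ j ⌋ ∧ t (ℓ i) (ℓ j)) i j) ⟩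
    (not ⌊ i ≟ j ⌋ ∧ t (ℓ i) (ℓ j)) xor (not ⌊ i ≟ j ⌋ ∧ t s (ℓ i) ∧ t s (ℓ j))
      ≡⟨ ∧-distribˡ-xor (not ⌊ i ≟ j ⌋) _ _ ⟨
    not ⌊ i ≟ j ⌋ ∧ lcTable s t (ℓ i) (ℓ j)
      ≡⟨ adj-tabulate (λ i j → not ⌊ i ≟ j ⌋ ∧ lcTable s t (ℓ i) (ℓ j)) i j ⟨
    adj (tableGraph ℓ (lcTable s t)) i j ∎
    where
    open ≡-Reasoning
    G : Graph N
    G = tableGraph ℓ t
    s : L
    s = ℓ v
    neighbour : ∀ k → adj G v k ≡ t s (ℓ k)
    neighbour k with v ≟ k
    ... | yes refl = trans (adj-tabulate _ v v)
                       (trans (cong (λ d → not d ∧ t s s) (⌊≟⌋-true {x = v} refl)) (sym loopless))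
    ... | no v≢k = adj-tableGraph ℓ t v≢k

  LocallyEquivalent-invariant : (P : Graph N → Set) → (∀ v {H} → P H → P (localComplement v H)) →
                                ∀ {G H} → LocallyEquivalent G H → P G → P H
  LocallyEquivalent-invariant P step ε               = id
  LocallyEquivalent-invariant P step (lc v _ ◅ G↝H) =
    LocallyEquivalent-invariant P step G↝H ∘ step v

  orbitSize-enumeration : {k : ℕ} {C : Set} {G : Graph N} (code : Fin k ↔ C) (f : C → Graph N) →
    (∀ {c c′} → f c ≡ f c′ → c ≡ c′) →
    (∀ c → LocallyEquivalent G (f c)) →
    (∀ {H} → LocallyEquivalent G H → ∃[ c ] H ≡ f c) →
    OrbitSize G k
  orbitSize-enumeration {G = G} code f f-injective reach cover =
    List.tabulate (f ∘ to) , tabulate⁺ (to-injective ∘ f-injective) , length-tabulate (f ∘ to) ,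
    λ H → mk⇔ (listed⇒reachable H) (reachable⇒listed H)
    where
    open Inverse code
    to-injective : ∀ {i j} → to i ≡ to j → i ≡ j
    to-injective {i} {j} eq =
      trans (sym (strictlyInverseʳ i)) (trans (cong from eq) (strictlyInverseʳ j))
    listed⇒reachable : ∀ H → H ∈ List.tabulate (f ∘ to) → LocallyEquivalent G H
    listed⇒reachable H H∈ with ∈-tabulate⁻ H∈
    ... | i , refl = reach (to i)
    reachable⇒listed : ∀ H → LocallyEquivalent G H → H ∈ List.tabulate (f ∘ to)
    reachable⇒listed H G↝H with cover G↝H
    ... | c , refl =
      subst (λ c → f c ∈ List.tabulate (f ∘ to)) (strictlyInverseˡ c) (∈-tabulate⁺ (from c))

-- The flag marks the distinguished vertex of the part (a in A, b in B).
data Label : Set where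
  inA inB : Bool → Label

-- cliqueA is K_{n,m} plus a clique on A; hubA has the edges from a to all other vertices and
-- a clique on B; doubleStar has the edges from a to A∖{a} and to b, and from b to B∖{b}.
data Shape : Set where
  complete cliqueA cliqueB hubA hubB doubleStar : Shape

withinA : Shape → Bool → Bool → Bool
withinA complete   _ _  = false
withinA cliqueA    p p′ = not (p ∧ p′)
withinA cliqueB    _ _  = false
withinA hubA       p p′ = p xor p′
withinA hubB       p p′ = not (p ∧ p′)
withinA doubleStar p p′ = p xor p′

withinB : Shape → Bool → Bool → Bool
withinB complete   _ _  = false
withinB cliqueA    _ _  = false
withinB cliqueB    q q′ = not (q ∧ q′)
withinB hubA       q q′ = not (q ∧ q′)
withinB hubB       q q′ = q xor q′
withinB doubleStar q q′ = q xor q′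

acrossA : Shape → Bool → Bool
acrossA hubA       p = p
acrossA doubleStar p = p
acrossA _          _ = true

acrossB : Shape → Bool → Bool
acrossB hubB       q = q
acrossB doubleStar q = q
acrossB _          _ = true

edge : Shape → Table Label
edge s (inA p) (inA p′) = withinA s p p′
edge s (inA p) (inB q)  = acrossA s p ∧ acrossB s q
edge s (inB q) (inA p)  = acrossA s p ∧ acrossB s q
edge s (inB q) (inB q′) = withinB s q q′

side : Label → Bool
side (inA _) = true
side (inB _) = false

edge-complete : ∀ x y → edge complete x y ≡ side x xor side y
edge-complete (inA _) (inA _) = refl
edge-complete (inA _) (inB _) = refl
edge-complete (inB _) (inA _) = refl
edge-complete (inB _) (inB _) = refl

lcA : Shape → Shape
lcA complete   = cliqueB
lcA cliqueA    = hubA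
lcA cliqueB    = complete
lcA hubA       = cliqueA
lcA hubB       = doubleStar
lcA doubleStar = hubB

lcB : Shape → Shape
lcB complete   = cliqueA
lcB cliqueA    = complete
lcB cliqueB    = hubB
lcB hubA       = doubleStar
lcB hubB       = cliqueB
lcB doubleStar = hubA

-- Two distinct vertices never both carry the flag of one part, so only realizable pairs of
-- labels matter when two tables are compared.
realizable : Label → Label → Bool
realizable (inA p) (inA p′) = not (p ∧ p′)
realizable (inB q) (inB q′) = not (q ∧ q′)
realizable _       _        = true

infix 4 _≈_ _≈?_

_≈_ : Table Label → Table Label → Set
t ≈ t′ = ∀ x y → T (realizable x y) → t x y ≡ t′ x y

forgetA : Label → Label
forgetA (inA _) = inA false
forgetA (inB q) = inB q

forgetB : Label → Label
forgetB (inA p) = inA p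
forgetB (inB _) = inB false

TwinsA : Shape → Set
TwinsA s = edge s ≈ λ x y → edge s (forgetA x) (forgetA y)

TwinsB : Shape → Set
TwinsB s = edge s ≈ λ x y → edge s (forgetB x) (forgetB y)

InertA : Shape → Set
InertA s = edge s (inA false) (inA false) ≡ false × lcTable (inA false) (edge s) ≈ edge s

InertB : Shape → Set
InertB s = edge s (inB false) (inB false) ≡ false × lcTable (inB false) (edge s) ≈ edge s

∀-Bool? : {P : Bool → Set} → (∀ b → Dec (P b)) → Dec (∀ b → P b)
∀-Bool? P? = map′ (λ (f , t) → λ { false → f ; true → t }) (λ h → h false , h true)
                  (P? false ×-dec P? true)

∀-Label? : {P : Label → Set} → (∀ x → Dec (P x)) → Dec (∀ x → P x)
∀-Label? P? = map′ (λ (a , b) → λ { (inA p) → a p ; (inB q) → b q }) (λ h → h ∘ inA , h ∘ inB)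
                   (∀-Bool? (P? ∘ inA) ×-dec ∀-Bool? (P? ∘ inB))

∀-Shape? : {P : Shape → Set} → (∀ s → Dec (P s)) → Dec (∀ s → P s)
∀-Shape? P? =
  map′ (λ (c , ca , cb , ha , hb , d) → λ
         { complete → c ; cliqueA → ca ; cliqueB → cb ; hubA → ha ; hubB → hb ; doubleStar → d })
       (λ h → h complete , h cliqueA , h cliqueB , h hubA , h hubB , h doubleStar)
       (P? complete ×-dec P? cliqueA ×-dec P? cliqueB ×-dec
        P? hubA ×-dec P? hubB ×-dec P? doubleStar)

_≈?_ : (t t′ : Table Label) → Dec (t ≈ t′)
t ≈? t′ = ∀-Label? λ x → ∀-Label? λ y → T? (realizable x y) →-dec t x y ≟ᵇ t′ x y

twinsA? : ∀ s → Dec (TwinsA s)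
twinsA? s = edge s ≈? λ x y → edge s (forgetA x) (forgetA y)

twinsB? : ∀ s → Dec (TwinsB s)
twinsB? s = edge s ≈? λ x y → edge s (forgetB x) (forgetB y)

inertA? : ∀ s → Dec (InertA s)
inertA? s = edge s (inA false) (inA false) ≟ᵇ false ×-dec lcTable (inA false) (edge s) ≈? edge s

inertB? : ∀ s → Dec (InertB s)
inertB? s = edge s (inB false) (inB false) ≟ᵇ false ×-dec lcTable (inB false) (edge s) ≈? edge s

loopless : ∀ s → edge s (inA true) (inA true) ≡ false × edge s (inB true) (inB true) ≡ false
loopless = from-yes (∀-Shape? λ s →
  edge s (inA true) (inA true) ≟ᵇ false ×-dec edge s (inB true) (inB true) ≟ᵇ false)

lcA-edge : ∀ s → lcTable (inA true) (edge s) ≈ edge (lcA s)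
lcA-edge = from-yes (∀-Shape? λ s → lcTable (inA true) (edge s) ≈? edge (lcA s))

lcB-edge : ∀ s → lcTable (inB true) (edge s) ≈ edge (lcB s)
lcB-edge = from-yes (∀-Shape? λ s → lcTable (inB true) (edge s) ≈? edge (lcB s))

twins-or-inertA : ∀ s → TwinsA s ⊎ InertA s
twins-or-inertA = from-yes (∀-Shape? λ s → twinsA? s ⊎-dec inertA? s)

twins-or-inertB : ∀ s → TwinsB s ⊎ InertB s
twins-or-inertB = from-yes (∀-Shape? λ s → twinsB? s ⊎-dec inertB? s)

twinsA : ∀ s → {True (twinsA? s)} → TwinsA s
twinsA s {holds} = toWitness holds

twinsB : ∀ s → {True (twinsB? s)} → TwinsB s
twinsB s {holds} = toWitness holds

module Shapes (n m : ℕ) where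

  data Part : Fin (n + m) → Set where
    left  : (x : Fin n) → Part (x ↑ˡ m)
    right : (y : Fin m) → Part (n ↑ʳ y)

  part : ∀ i → Part i
  part i with splitAt n i in eq
  ... | inj₁ x = subst Part (splitAt⁻¹-↑ˡ eq) (left x)
  ... | inj₂ y = subst Part (splitAt⁻¹-↑ʳ eq) (right y)

  ↑ˡ<n : ∀ (x : Fin n) → toℕ (x ↑ˡ m) < n
  ↑ˡ<n x = subst (_< n) (sym (toℕ-↑ˡ x m)) (toℕ<n x)

  ↑ʳ≮n : ∀ (y : Fin m) → ¬ toℕ (n ↑ʳ y) < n
  ↑ʳ≮n y = m+n≮m n (toℕ y) ∘ subst (_< n) (toℕ-↑ʳ n y)

  ↑ˡ≢↑ʳ : ∀ x y → x ↑ˡ m ≢ n ↑ʳ y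
  ↑ˡ≢↑ʳ x y eq = ↑ʳ≮n y (subst (λ i → toℕ i < n) eq (↑ˡ<n x))

  labelA : Fin n → Fin n → Label
  labelA a x = inA ⌊ x ≟ a ⌋

  labelB : Fin m → Fin m → Label
  labelB b y = inB ⌊ y ≟ b ⌋

  label : Fin n → Fin m → Fin (n + m) → Label
  label a b i = [ labelA a , labelB b ]′ (splitAt n i)

  label-↑ˡ : ∀ a b x → label a b (x ↑ˡ m) ≡ labelA a x
  label-↑ˡ a b x = cong [ labelA a , labelB b ]′ (splitAt-↑ˡ n x m)

  label-↑ʳ : ∀ a b y → label a b (n ↑ʳ y) ≡ labelB b y
  label-↑ʳ a b y = cong [ labelA a , labelB b ]′ (splitAt-↑ʳ n m y)

  graph : Shape → Fin n → Fin m → Graph (n + m)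
  graph s a b = tableGraph (label a b) (edge s)

  adj-graph : ∀ s a b {i j} → i ≢ j → adj (graph s a b) i j ≡ edge s (label a b i) (label a b j)
  adj-graph s a b = adj-tableGraph (label a b) (edge s)

  flags-exclusive : ∀ {k} (c : Fin k) {x x′} → x ≢ x′ → T (not (⌊ x ≟ c ⌋ ∧ ⌊ x′ ≟ c ⌋))
  flags-exclusive c {x} {x′} x≢x′ with x ≟ c | x′ ≟ c
  ... | yes refl | yes refl = x≢x′ refl
  ... | yes _    | no _     = _
  ... | no _     | _        = _

  realizable-label : ∀ a b {i j} → i ≢ j → T (realizable (label a b i) (label a b j))
  realizable-label a b {i} {j} i≢j with part i | part j
  ... | left x  | left x′
    rewrite label-↑ˡ a b x | label-↑ˡ a b x′ = flags-exclusive a (i≢j ∘ cong (_↑ˡ m))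
  ... | left x  | right y
    rewrite label-↑ˡ a b x | label-↑ʳ a b y = _
  ... | right y | left x
    rewrite label-↑ʳ a b y | label-↑ˡ a b x = _
  ... | right y | right y′
    rewrite label-↑ʳ a b y | label-↑ʳ a b y′ = flags-exclusive b (i≢j ∘ cong (n ↑ʳ_))

  graph-≈ : ∀ a b {t t′} → t ≈ t′ → tableGraph (label a b) t ≡ tableGraph (label a b) t′
  graph-≈ a b {t} {t′} t≈t′ = tableGraph-cong (label a b) (label a b) t t′ λ {i} {j} i≢j →
    t≈t′ (label a b i) (label a b j) (realizable-label a b i≢j)

  relabelA : ∀ {s} → TwinsA s → ∀ a a′ b → graph s a b ≡ graph s a′ b
  relabelA {s} twins a a′ b = begin
    graph s a b                                  ≡⟨ graph-≈ a b twins ⟩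
    tableGraph (forgetA ∘ label a b) (edge s)   ≡⟨ tableGraph-≗ (edge s) forget-label ⟩
    tableGraph (forgetA ∘ label a′ b) (edge s)  ≡⟨ graph-≈ a′ b twins ⟨
    graph s a′ b                                 ∎
    where
    open ≡-Reasoning
    forget-label : ∀ i → forgetA (label a b i) ≡ forgetA (label a′ b i)
    forget-label i with part i
    ... | left x  rewrite label-↑ˡ a b x | label-↑ˡ a′ b x = refl
    ... | right y rewrite label-↑ʳ a b y | label-↑ʳ a′ b y = refl

  relabelB : ∀ {s} → TwinsB s → ∀ a b b′ → graph s a b ≡ graph s a b′
  relabelB {s} twins a b b′ = begin
    graph s a b                                  ≡⟨ graph-≈ a b twins ⟩
    tableGraph (forgetB ∘ label a b) (edge s)   ≡⟨ tableGraph-≗ (edge s) forget-label ⟩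
    tableGraph (forgetB ∘ label a b′) (edge s)  ≡⟨ graph-≈ a b′ twins ⟨
    graph s a b′                                 ∎
    where
    open ≡-Reasoning
    forget-label : ∀ i → forgetB (label a b i) ≡ forgetB (label a b′ i)
    forget-label i with part i
    ... | left x  rewrite label-↑ˡ a b x | label-↑ˡ a b′ x = refl
    ... | right y rewrite label-↑ʳ a b y | label-↑ʳ a b′ y = refl

  localComplement-graph : ∀ {s s′} a b v {l} → label a b v ≡ l →
                          edge s l l ≡ false → lcTable l (edge s) ≈ edge s′ →
                          localComplement v (graph s a b) ≡ graph s′ a b
  localComplement-graph {s} a b v refl loopless lc≈ =
    trans (localComplement-tableGraph (label a b) (edge s) v loopless) (graph-≈ a b lc≈)

  localComplement-at-a : ∀ s a b → localComplement (a ↑ˡ m) (graph s a b) ≡ graph (lcA s) a b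
  localComplement-at-a s a b = localComplement-graph a b (a ↑ˡ m)
    (trans (label-↑ˡ a b a) (cong inA (⌊≟⌋-true refl))) (proj₁ (loopless s)) (lcA-edge s)

  localComplement-at-b : ∀ s a b → localComplement (n ↑ʳ b) (graph s a b) ≡ graph (lcB s) a b
  localComplement-at-b s a b = localComplement-graph a b (n ↑ʳ b)
    (trans (label-↑ʳ a b b) (cong inB (⌊≟⌋-true refl))) (proj₂ (loopless s)) (lcB-edge s)

  localComplement-inertA : ∀ {s} → InertA s → ∀ a b {x} → x ≢ a →
                           localComplement (x ↑ˡ m) (graph s a b) ≡ graph s a b
  localComplement-inertA (loopless , lc≈) a b {x} x≢a = localComplement-graph a b (x ↑ˡ m)
    (trans (label-↑ˡ a b x) (cong inA (⌊≟⌋-false x≢a))) loopless lc≈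

  localComplement-inertB : ∀ {s} → InertB s → ∀ a b {y} → y ≢ b →
                           localComplement (n ↑ʳ y) (graph s a b) ≡ graph s a b
  localComplement-inertB (loopless , lc≈) a b {y} y≢b = localComplement-graph a b (n ↑ʳ y)
    (trans (label-↑ʳ a b y) (cong inB (⌊≟⌋-false y≢b))) loopless lc≈

  InFamily : Graph (n + m) → Set
  InFamily H = ∃[ s ] ∃[ a ] ∃[ b ] H ≡ graph s a b

  localComplement-left : ∀ s a b x → InFamily (localComplement (x ↑ˡ m) (graph s a b))
  localComplement-left s a b x with twins-or-inertA s
  ... | inj₁ twins = lcA s , x , b ,
    trans (cong (localComplement (x ↑ˡ m)) (relabelA twins a x b)) (localComplement-at-a s x b)
  ... | inj₂ inert with x ≟ a
  ...   | yes refl = lcA s , a , b , localComplement-at-a s a b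
  ...   | no x≢a   = s , a , b , localComplement-inertA inert a b x≢a

  localComplement-right : ∀ s a b y → InFamily (localComplement (n ↑ʳ y) (graph s a b))
  localComplement-right s a b y with twins-or-inertB s
  ... | inj₁ twins = lcB s , a , y ,
    trans (cong (localComplement (n ↑ʳ y)) (relabelB twins a b y)) (localComplement-at-b s a y)
  ... | inj₂ inert with y ≟ b
  ...   | yes refl = lcB s , a , b , localComplement-at-b s a b
  ...   | no y≢b   = s , a , b , localComplement-inertB inert a b y≢b

  localComplement-InFamily : ∀ v {H} → InFamily H → InFamily (localComplement v H)
  localComplement-InFamily v (s , a , b , refl) with part v
  ... | left x  = localComplement-left s a b x
  ... | right y = localComplement-right s a b y

  completeBipartite≡graph : ∀ a b → completeBipartite n m ≡ graph complete a b
  completeBipartite≡graph a b = graph-ext λ i j →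
    trans (adj-tabulate (λ i j → inFirst n i xor inFirst n j) i j) (sides i j (i ≟ j))
    where
    inFirst-side : ∀ i → inFirst n i ≡ side (label a b i)
    inFirst-side i with part i
    ... | left x  rewrite label-↑ˡ a b x =
      trans (isYes≗does (toℕ (x ↑ˡ m) <? n)) (dec-true (toℕ (x ↑ˡ m) <? n) (↑ˡ<n x))
    ... | right y rewrite label-↑ʳ a b y =
      trans (isYes≗does (toℕ (n ↑ʳ y) <? n)) (dec-false (toℕ (n ↑ʳ y) <? n) (↑ʳ≮n y))
    sides : ∀ i j → Dec (i ≡ j) → inFirst n i xor inFirst n j ≡ adj (graph complete a b) i j
    sides i .i (yes refl)
      rewrite adj-tabulate (λ i j → not ⌊ i ≟ j ⌋ ∧ edge complete (label a b i) (label a b j)) i i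
            | ⌊≟⌋-true {x = i} refl = xor-same (inFirst n i)
    sides i j  (no i≢j)   = trans (cong₂ _xor_ (inFirst-side i) (inFirst-side j))
      (trans (sym (edge-complete (label a b i) (label a b j)))
             (sym (adj-tableGraph (label a b) (edge complete) i≢j)))

  adj-across : ∀ s a b x y →
               adj (graph s a b) (x ↑ˡ m) (n ↑ʳ y) ≡ acrossA s ⌊ x ≟ a ⌋ ∧ acrossB s ⌊ y ≟ b ⌋
  adj-across s a b x y
    rewrite adj-graph s a b (↑ˡ≢↑ʳ x y) | label-↑ˡ a b x | label-↑ʳ a b y = refl

  adj-withinA : ∀ s a b {x x′} → x ≢ x′ →
                adj (graph s a b) (x ↑ˡ m) (x′ ↑ˡ m) ≡ withinA s ⌊ x ≟ a ⌋ ⌊ x′ ≟ a ⌋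
  adj-withinA s a b {x} {x′} x≢x′
    rewrite adj-graph s a b (x≢x′ ∘ ↑ˡ-injective m x x′) | label-↑ˡ a b x | label-↑ˡ a b x′ = refl

  adj-withinB : ∀ s a b {y y′} → y ≢ y′ →
                adj (graph s a b) (n ↑ʳ y) (n ↑ʳ y′) ≡ withinB s ⌊ y ≟ b ⌋ ⌊ y′ ≟ b ⌋
  adj-withinB s a b {y} {y′} y≢y′
    rewrite adj-graph s a b (y≢y′ ∘ ↑ʳ-injective n y y′) | label-↑ʳ a b y | label-↑ʳ a b y′ = refl

module Orbit (n′ m′ : ℕ) where

  n m : ℕ
  n = 2 + n′
  m = 2 + m′

  open Shapes n m

  Code : Set
  Code = (((Fin n × Fin m) ⊎ Fin n) ⊎ Fin m) ⊎ Fin 3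

  pattern doubleStarᶜ a b = inj₁ (inj₁ (inj₁ (a , b)))
  pattern hubAᶜ a         = inj₁ (inj₁ (inj₂ a))
  pattern hubBᶜ b         = inj₁ (inj₂ b)
  pattern completeᶜ       = inj₂ zero
  pattern cliqueAᶜ        = inj₂ (suc zero)
  pattern cliqueBᶜ        = inj₂ (suc (suc zero))

  code : Fin (n * m + n + m + 3) ↔ Code
  code = (((((*↔× ⊎-↔ ↔-id _) ↔-∘ +↔⊎) ⊎-↔ ↔-id _) ↔-∘ +↔⊎) ⊎-↔ ↔-id _) ↔-∘ +↔⊎

  encode : Code → Graph (n + m)
  encode (doubleStarᶜ a b) = graph doubleStar a b
  encode (hubAᶜ a)         = graph hubA a zero
  encode (hubBᶜ b)         = graph hubB zero b
  encode completeᶜ         = graph complete zero zero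
  encode cliqueAᶜ          = graph cliqueA zero zero
  encode cliqueBᶜ          = graph cliqueB zero zero

  canonical : ∀ {H} → InFamily H → ∃[ c ] H ≡ encode c
  canonical (complete , a , b , refl) = completeᶜ ,
    trans (relabelA (twinsA complete) a zero b) (relabelB (twinsB complete) zero b zero)
  canonical (cliqueA , a , b , refl) = cliqueAᶜ ,
    trans (relabelA (twinsA cliqueA) a zero b) (relabelB (twinsB cliqueA) zero b zero)
  canonical (cliqueB , a , b , refl) = cliqueBᶜ ,
    trans (relabelA (twinsA cliqueB) a zero b) (relabelB (twinsB cliqueB) zero b zero)
  canonical (hubA , a , b , refl)       = hubAᶜ a , relabelB (twinsB hubA) a b zero
  canonical (hubB , a , b , refl)       = hubBᶜ b , relabelA (twinsA hubB) a zero b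
  canonical (doubleStar , a , b , refl) = doubleStarᶜ a b , refl

  orbit⊆encode : ∀ {H} → LocallyEquivalent (completeBipartite n m) H → ∃[ c ] H ≡ encode c
  orbit⊆encode K↝H = canonical
    (LocallyEquivalent-invariant InFamily localComplement-InFamily K↝H
       (complete , zero , zero , completeBipartite≡graph zero zero))

  module _ where
    open StarReasoning (LCStep {n + m})

    lcA-step : ∀ s a b → LocallyEquivalent (graph s a b) (graph (lcA s) a b)
    lcA-step s a b = begin
      graph s a b                              ⟶⟨ lc (a ↑ˡ m) _ ⟩
      localComplement (a ↑ˡ m) (graph s a b)   ≡⟨ localComplement-at-a s a b ⟩
      graph (lcA s) a b                        ∎

    lcB-step : ∀ s a b → LocallyEquivalent (graph s a b) (graph (lcB s) a b)
    lcB-step s a b = begin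
      graph s a b                              ⟶⟨ lc (n ↑ʳ b) _ ⟩
      localComplement (n ↑ʳ b) (graph s a b)   ≡⟨ localComplement-at-b s a b ⟩
      graph (lcB s) a b                        ∎

    K↝complete : LocallyEquivalent (completeBipartite n m) (graph complete zero zero)
    K↝complete = begin
      completeBipartite n m      ≡⟨ completeBipartite≡graph zero zero ⟩
      graph complete zero zero   ∎

    K↝cliqueA : LocallyEquivalent (completeBipartite n m) (graph cliqueA zero zero)
    K↝cliqueA = begin
      completeBipartite n m      ⟶*⟨ K↝complete ⟩
      graph complete zero zero   ⟶*⟨ lcB-step complete zero zero ⟩
      graph cliqueA zero zero    ∎

    K↝cliqueB : LocallyEquivalent (completeBipartite n m) (graph cliqueB zero zero)
    K↝cliqueB = begin
      completeBipartite n m      ⟶*⟨ K↝complete ⟩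
      graph complete zero zero   ⟶*⟨ lcA-step complete zero zero ⟩
      graph cliqueB zero zero    ∎

    K↝hubA : ∀ a → LocallyEquivalent (completeBipartite n m) (graph hubA a zero)
    K↝hubA a = begin
      completeBipartite n m      ⟶*⟨ K↝cliqueA ⟩
      graph cliqueA zero zero    ≡⟨ relabelA (twinsA cliqueA) zero a zero ⟩
      graph cliqueA a zero       ⟶*⟨ lcA-step cliqueA a zero ⟩
      graph hubA a zero          ∎

    K↝hubB : ∀ b → LocallyEquivalent (completeBipartite n m) (graph hubB zero b)
    K↝hubB b = begin
      completeBipartite n m      ⟶*⟨ K↝cliqueB ⟩
      graph cliqueB zero zero    ≡⟨ relabelB (twinsB cliqueB) zero zero b ⟩
      graph cliqueB zero b       ⟶*⟨ lcB-step cliqueB zero b ⟩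
      graph hubB zero b          ∎

    K↝doubleStar : ∀ a b → LocallyEquivalent (completeBipartite n m) (graph doubleStar a b)
    K↝doubleStar a b = begin
      completeBipartite n m      ⟶*⟨ K↝hubB b ⟩
      graph hubB zero b          ≡⟨ relabelA (twinsA hubB) zero a b ⟩
      graph hubB a b             ⟶*⟨ lcA-step hubB a b ⟩
      graph doubleStar a b       ∎

  reachable : ∀ c → LocallyEquivalent (completeBipartite n m) (encode c)
  reachable (doubleStarᶜ a b) = K↝doubleStar a b
  reachable (hubAᶜ a)         = K↝hubA a
  reachable (hubBᶜ b)         = K↝hubB b
  reachable completeᶜ         = K↝complete
  reachable cliqueAᶜ          = K↝cliqueA
  reachable cliqueBᶜ          = K↝cliqueB

  rows : Code → Maybe (Fin n)
  rows (doubleStarᶜ a _) = just a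
  rows (hubAᶜ a)         = just a
  rows _                 = nothing

  cols : Code → Maybe (Fin m)
  cols (doubleStarᶜ _ b) = just b
  cols (hubBᶜ b)         = just b
  cols _                 = nothing

  adj-across-encode : ∀ c x y →
                      adj (encode c) (x ↑ˡ m) (n ↑ʳ y) ≡ select (rows c) x ∧ select (cols c) y
  adj-across-encode (doubleStarᶜ a b) = adj-across doubleStar a b
  adj-across-encode (hubAᶜ a)         = adj-across hubA a zero
  adj-across-encode (hubBᶜ b)         = adj-across hubB zero b
  adj-across-encode completeᶜ         = adj-across complete zero zero
  adj-across-encode cliqueAᶜ          = adj-across cliqueA zero zero
  adj-across-encode cliqueBᶜ          = adj-across cliqueB zero zero

  a₀ a₁ : Fin n
  a₀ = zero
  a₁ = suc zero

  b₀ b₁ : Fin m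
  b₀ = zero
  b₁ = suc zero

  inner : Graph (n + m) → Bool × Bool
  inner G = adj G (a₀ ↑ˡ m) (a₁ ↑ˡ m) , adj G (n ↑ʳ b₀) (n ↑ʳ b₁)

  inner-graph : ∀ s → inner (graph s zero zero) ≡ (withinA s true false , withinB s true false)
  inner-graph s =
    cong₂ _,_ (adj-withinA s zero zero {a₀} {a₁} λ ()) (adj-withinB s zero zero {b₀} {b₁} λ ())

  Signature : Set
  Signature = Maybe (Fin n) × Maybe (Fin m) × Bool × Bool

  signature : Code → Signature
  signature c = rows c , cols c , inner (encode c)

  decode : Signature → Code
  decode (just a  , just b  , _)            = doubleStarᶜ a b
  decode (just a  , nothing , _)            = hubAᶜ a
  decode (nothing , just b  , _)            = hubBᶜ b
  decode (nothing , nothing , true  , _)    = cliqueAᶜ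
  decode (nothing , nothing , false , true) = cliqueBᶜ
  decode (nothing , nothing , false , false) = completeᶜ

  decode-signature : ∀ c → decode (signature c) ≡ c
  decode-signature (doubleStarᶜ a b) = refl
  decode-signature (hubAᶜ a)         = refl
  decode-signature (hubBᶜ b)         = refl
  decode-signature completeᶜ =
    cong (λ bits → decode (nothing , nothing , bits)) (inner-graph complete)
  decode-signature cliqueAᶜ =
    cong (λ bits → decode (nothing , nothing , bits)) (inner-graph cliqueA)
  decode-signature cliqueBᶜ =
    cong (λ bits → decode (nothing , nothing , bits)) (inner-graph cliqueB)

  signature-cong : ∀ {c c′} → encode c ≡ encode c′ → signature c ≡ signature c′
  signature-cong {c} {c′} eq =
    cong₂ _,_ rows≡ (cong₂ _,_ cols≡ (cong inner eq))
    where
    across≡ : ∀ x y →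
              select (rows c) x ∧ select (cols c) y ≡ select (rows c′) x ∧ select (cols c′) y
    across≡ x y = trans (sym (adj-across-encode c x y))
                        (trans (cong (λ G → adj G (x ↑ˡ m) (n ↑ʳ y)) eq) (adj-across-encode c′ x y))
    rows≡ : rows c ≡ rows c′
    rows≡ = proj₁ (rectangle-injective {r = rows c} {rows c′} {cols c} {cols c′} across≡)
    cols≡ : cols c ≡ cols c′
    cols≡ = proj₂ (rectangle-injective {r = rows c} {rows c′} {cols c} {cols c′} across≡)

  encode-injective : ∀ {c c′} → encode c ≡ encode c′ → c ≡ c′
  encode-injective {c} {c′} eq = begin
    c                        ≡⟨ decode-signature c ⟨
    decode (signature c)     ≡⟨ cong decode (signature-cong eq) ⟩
    decode (signature c′)    ≡⟨ decode-signature c′ ⟩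
    c′                       ∎
    where open ≡-Reasoning

  orbitSize : OrbitSize (completeBipartite n m) (n * m + n + m + 3)
  orbitSize = orbitSize-enumeration code encode encode-injective reachable orbit⊆encode

theorem4 : (n m : ℕ) → 2 ≤ n → 2 ≤ m →
    OrbitSize (completeBipartite n m) (n * m + n + m + 3)
theorem4 _ _ (s≤s (s≤s _)) (s≤s (s≤s _)) = Orbit.orbitSize _ _
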